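{- Let $P:\mathcal{C}^{op}\to\mathbf{InfSL}$ be an elementary doctrine with full comprehensions and comprehensive equalizers. If $f:A\to B$ is a monomorphism in $\mathcal{C}$, then $P_{f\times f}(\delta_B)=\delta_A$.
   Context: A primary doctrine is a functor $P:\mathcal{C}^{op}\to\mathbf{InfSL}$ where $\mathcal{C}$ has finite products, each $P(A)$ is a poset with finite meets (top $\top_A$) and each $P_f$ preserves them. Write $f\times f'=\langle f\circ pr_1,f'\circ pr_2\rangle$, $\Delta_A=\langle id_A,id_A\rangle$. $P$ is elementary if each $P_{id_C\times\Delta_A}$ has a left adjoint $\exists_{id_C\times\Delta_A}$ satisfying Frobenius reciprocity; $\delta_A=\exists_{\Delta_A}(\top_A)\in P(A\times A)$. A comprehension of $\alpha\in P(A)$ is $\{\alpha\}:X\to A$ with $\top_X\le P_{\{\alpha\}}(\alpha)$ such that every $g:Y\to A$ with $\top_Y\le P_g(\alpha)$ factors uniquely through $\{\alpha\}$; it is full if for all $\beta\in P(A)$, $\top_X\le P_{\{\alpha\}}(\beta)$ implies $\alpha\le\beta$; $P$ has full comprehensions if every $\alpha$ has a full comprehension. $P$ has comprehensive equalizers if for every object $A$ the diagonal $\Delta_A$ is a stable comprehension of $\delta_A$ (stable: every reindexing $P_f(\delta_A)$ along $f:A'\to A\times A$ has a comprehension). -}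

module Defs where

open import Level using (Level; _⊔_) renaming (suc to lsuc)
open import Relation.Binary using (Rel; IsEquivalence)
open import Relation.Binary.Lattice.Bundles using (BoundedMeetSemilattice)
open import Data.Product using (Σ; Σ-syntax; _×_; _,_)

record Category (o ℓ e : Level) : Set (lsuc (o ⊔ ℓ ⊔ e)) where
  infixr 9 _∘_
  infix  4 _⇒_
  infix  4 _≈_
  field
    Obj    : Set o
    _⇒_    : Obj → Obj → Set ℓ
    _≈_    : ∀ {A B} → Rel (A ⇒ B) e
    id     : ∀ {A} → A ⇒ A
    _∘_    : ∀ {A B C} → B ⇒ C → A ⇒ B → A ⇒ C
    ≈-equiv   : ∀ {A B} → IsEquivalence (_≈_ {A} {B})
    assoc     : ∀ {A B C D} {f : A ⇒ B} {g : B ⇒ C} {h : C ⇒ D} →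
                (h ∘ g) ∘ f ≈ h ∘ (g ∘ f)
    identityˡ : ∀ {A B} {f : A ⇒ B} → id ∘ f ≈ f
    identityʳ : ∀ {A B} {f : A ⇒ B} → f ∘ id ≈ f
    ∘-resp-≈  : ∀ {A B C} {f h : B ⇒ C} {g i : A ⇒ B} →
                f ≈ h → g ≈ i → f ∘ g ≈ h ∘ i

record CartesianCategory (o ℓ e : Level) : Set (lsuc (o ⊔ ℓ ⊔ e)) where
  field
    category : Category o ℓ e
  open Category category
  infixr 7 _⊗_
  field
    𝟙       : Obj
    !       : ∀ {A} → A ⇒ 𝟙
    !-unique : ∀ {A} (h : A ⇒ 𝟙) → h ≈ !
    _⊗_     : Obj → Obj → Obj
    π₁      : ∀ {A B} → A ⊗ B ⇒ A
    π₂      : ∀ {A B} → A ⊗ B ⇒ B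
    ⟨_,_⟩   : ∀ {A B C} → C ⇒ A → C ⇒ B → C ⇒ A ⊗ B
    project₁ : ∀ {A B C} {f : C ⇒ A} {g : C ⇒ B} → π₁ ∘ ⟨ f , g ⟩ ≈ f
    project₂ : ∀ {A B C} {f : C ⇒ A} {g : C ⇒ B} → π₂ ∘ ⟨ f , g ⟩ ≈ g
    ⟨⟩-unique : ∀ {A B C} {f : C ⇒ A} {g : C ⇒ B} (h : C ⇒ A ⊗ B) →
                π₁ ∘ h ≈ f → π₂ ∘ h ≈ g → h ≈ ⟨ f , g ⟩

  _⁂_ : ∀ {A A' B B'} → A ⇒ B → A' ⇒ B' → A ⊗ A' ⇒ B ⊗ B'
  f ⁂ f' = ⟨ f ∘ π₁ , f' ∘ π₂ ⟩

  Δ : ∀ {A} → A ⇒ A ⊗ A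
  Δ = ⟨ id , id ⟩

  Mono : ∀ {A B} → A ⇒ B → Set (o ⊔ ℓ ⊔ e)
  Mono {A} f = ∀ {Z} (g h : Z ⇒ A) → f ∘ g ≈ f ∘ h → g ≈ h

record PrimaryDoctrine {o ℓ e} (𝒞 : CartesianCategory o ℓ e) (c ℓ₁ ℓ₂ : Level)
       : Set (lsuc (o ⊔ ℓ ⊔ e ⊔ c ⊔ ℓ₁ ⊔ ℓ₂)) where
  open CartesianCategory 𝒞
  open Category category
  field
    P    : Obj → BoundedMeetSemilattice c ℓ₁ ℓ₂
  module PA (A : Obj) = BoundedMeetSemilattice (P A)
  open PA using () renaming (Carrier to ∣P∣)
  field
    reindex : ∀ {A B} → A ⇒ B → ∣P∣ B → ∣P∣ A
    reindex-mono : ∀ {A B} (f : A ⇒ B) {α β : ∣P∣ B} →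
                   PA._≤_ B α β → PA._≤_ A (reindex f α) (reindex f β)
    reindex-⊤    : ∀ {A B} (f : A ⇒ B) → PA._≈_ A (reindex f (PA.⊤ B)) (PA.⊤ A)
    reindex-∧    : ∀ {A B} (f : A ⇒ B) (α β : ∣P∣ B) →
                   PA._≈_ A (reindex f (PA._∧_ B α β))
                            (PA._∧_ A (reindex f α) (reindex f β))
    reindex-id   : ∀ {A} (α : ∣P∣ A) → PA._≈_ A (reindex id α) α
    reindex-∘    : ∀ {A B C} (f : A ⇒ B) (g : B ⇒ C) (α : ∣P∣ C) →
                   PA._≈_ A (reindex (g ∘ f) α) (reindex f (reindex g α))
    reindex-resp : ∀ {A B} {f g : A ⇒ B} → f ≈ g → (α : ∣P∣ B) →
                   PA._≈_ A (reindex f α) (reindex g α)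

record Elementary {o ℓ e c ℓ₁ ℓ₂} {𝒞 : CartesianCategory o ℓ e}
       (D : PrimaryDoctrine 𝒞 c ℓ₁ ℓ₂) : Set (o ⊔ ℓ ⊔ e ⊔ c ⊔ ℓ₁ ⊔ ℓ₂) where
  open CartesianCategory 𝒞
  open Category category
  open PrimaryDoctrine D
  field
    ∃⟨_,_⟩ : ∀ C A → PA.Carrier (C ⊗ A) → PA.Carrier (C ⊗ (A ⊗ A))
    adjunction : ∀ {C A} (α : PA.Carrier (C ⊗ A)) (β : PA.Carrier (C ⊗ (A ⊗ A))) →
      (PA._≤_ (C ⊗ (A ⊗ A)) (∃⟨ C , A ⟩ α) β → PA._≤_ (C ⊗ A) α (reindex (id ⁂ Δ) β))
      × (PA._≤_ (C ⊗ A) α (reindex (id ⁂ Δ) β) → PA._≤_ (C ⊗ (A ⊗ A)) (∃⟨ C , A ⟩ α) β)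
    frobenius : ∀ {C A} (α : PA.Carrier (C ⊗ A)) (β : PA.Carrier (C ⊗ (A ⊗ A))) →
      PA._≈_ (C ⊗ (A ⊗ A))
        (∃⟨ C , A ⟩ (PA._∧_ (C ⊗ A) α (reindex (id ⁂ Δ) β)))
        (PA._∧_ (C ⊗ (A ⊗ A)) (∃⟨ C , A ⟩ α) β)

  -- ∃_{Δ_A} : P(A) → P(A × A) is the case C = 𝟙, transported along the
  -- canonical isomorphisms A ≅ 𝟙 × A and A × A ≅ 𝟙 × (A × A).
  ∃Δ : ∀ A → PA.Carrier A → PA.Carrier (A ⊗ A)
  ∃Δ A α = reindex ⟨ ! , id ⟩ (∃⟨ 𝟙 , A ⟩ (reindex π₂ α))

  δ : ∀ A → PA.Carrier (A ⊗ A)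
  δ A = ∃Δ A (PA.⊤ A)

module _ {o ℓ e c ℓ₁ ℓ₂} {𝒞 : CartesianCategory o ℓ e}
         (D : PrimaryDoctrine 𝒞 c ℓ₁ ℓ₂) where
  open CartesianCategory 𝒞
  open Category category
  open PrimaryDoctrine D

  IsComprehension : ∀ {A X} (α : PA.Carrier A) (cα : X ⇒ A) → Set (o ⊔ ℓ ⊔ e ⊔ ℓ₂)
  IsComprehension {A} {X} α cα =
    PA._≤_ X (PA.⊤ X) (reindex cα α)
    × (∀ {Y} (g : Y ⇒ A) → PA._≤_ Y (PA.⊤ Y) (reindex g α) →
         Σ[ h ∈ Y ⇒ X ] (g ≈ cα ∘ h × (∀ (h' : Y ⇒ X) → g ≈ cα ∘ h' → h' ≈ h)))

  IsFull : ∀ {A X} (α : PA.Carrier A) (cα : X ⇒ A) → Set (c ⊔ ℓ₂)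
  IsFull {A} {X} α cα =
    ∀ (β : PA.Carrier A) → PA._≤_ X (PA.⊤ X) (reindex cα β) → PA._≤_ A α β

  HasComprehension : ∀ {A} (α : PA.Carrier A) → Set (o ⊔ ℓ ⊔ e ⊔ ℓ₂)
  HasComprehension {A} α = Σ[ X ∈ Obj ] Σ[ cα ∈ X ⇒ A ] IsComprehension α cα

  HasFullComprehensions : Set (o ⊔ ℓ ⊔ e ⊔ c ⊔ ℓ₂)
  HasFullComprehensions =
    ∀ {A} (α : PA.Carrier A) →
      Σ[ X ∈ Obj ] Σ[ cα ∈ X ⇒ A ] (IsComprehension α cα × IsFull α cα)

  HasComprehensiveEqualizers : Elementary D → Set (o ⊔ ℓ ⊔ e ⊔ ℓ₂)
  HasComprehensiveEqualizers E =
    ∀ A → IsComprehension (δ A) (Δ {A})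
          × (∀ {A'} (f : A' ⇒ A ⊗ A) → HasComprehension (reindex f (δ A)))
    where open Elementary E

-- Write "g ⊩ α" for ⊤ ≤ P_g(α).  With full comprehensions a formula is determined
-- by the arrows along which it holds: take g to be its full comprehension.  Since
-- Δ_A comprehends δ_A, the arrows g along which δ_A holds are exactly those with
-- π₁ ∘ g ≈ π₂ ∘ g, and g ⊩ P_{f×f}(δ_B) iff (f × f) ∘ g ⊩ δ_B iff
-- f ∘ π₁ ∘ g ≈ f ∘ π₂ ∘ g, which for a monomorphism f means π₁ ∘ g ≈ π₂ ∘ g.
module Submission where

open import Defs
open import Data.Product using (_,_; proj₁)
open import Function.Bundles using (_⇔_; mk⇔; Equivalence)
open import Function.Properties.Equivalence using () renaming (sym to ⇔-sym)
open import Function.Related.Propositional using (module EquationalReasoning; equivalence)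
open import Relation.Binary using (IsEquivalence)
open import Relation.Binary.Lattice.Bundles using (BoundedMeetSemilattice)

module CartesianProperties {o ℓ e} (𝒞 : CartesianCategory o ℓ e) where
  open CartesianCategory 𝒞
  open Category category

  module ≈ {A B : Obj} = IsEquivalence (≈-equiv {A} {B})

  ≈-refl : ∀ {A B} {f : A ⇒ B} → f ≈ f
  ≈-refl = ≈.refl

  ≈-sym : ∀ {A B} {f g : A ⇒ B} → f ≈ g → g ≈ f
  ≈-sym = ≈.sym

  ≈-trans : ∀ {A B} {f g h : A ⇒ B} → f ≈ g → g ≈ h → f ≈ h
  ≈-trans = ≈.trans

  ∘-resp-≈ʳ : ∀ {A B C} {f : B ⇒ C} {g h : A ⇒ B} → g ≈ h → f ∘ g ≈ f ∘ h
  ∘-resp-≈ʳ = ∘-resp-≈ ≈-refl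

  π₁∘⁂ : ∀ {X A A' B B'} {f : A ⇒ B} {f' : A' ⇒ B'} {h : X ⇒ A ⊗ A'} →
         π₁ ∘ ((f ⁂ f') ∘ h) ≈ f ∘ (π₁ ∘ h)
  π₁∘⁂ = ≈-trans (≈-sym assoc) (≈-trans (∘-resp-≈ project₁ ≈-refl) assoc)

  π₂∘⁂ : ∀ {X A A' B B'} {f : A ⇒ B} {f' : A' ⇒ B'} {h : X ⇒ A ⊗ A'} →
         π₂ ∘ ((f ⁂ f') ∘ h) ≈ f' ∘ (π₂ ∘ h)
  π₂∘⁂ = ≈-trans (≈-sym assoc) (≈-trans (∘-resp-≈ project₂ ≈-refl) assoc)

  π₁∘Δ : ∀ {X A} {h : X ⇒ A} → π₁ ∘ (Δ ∘ h) ≈ h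
  π₁∘Δ = ≈-trans (≈-sym assoc) (≈-trans (∘-resp-≈ project₁ ≈-refl) identityˡ)

  π₂∘Δ : ∀ {X A} {h : X ⇒ A} → π₂ ∘ (Δ ∘ h) ≈ h
  π₂∘Δ = ≈-trans (≈-sym assoc) (≈-trans (∘-resp-≈ project₂ ≈-refl) identityˡ)

  factor-through-Δ : ∀ {X A} {h : X ⇒ A ⊗ A} → π₁ ∘ h ≈ π₂ ∘ h → h ≈ Δ ∘ (π₁ ∘ h)
  factor-through-Δ {h = h} π₁h≈π₂h =
    ≈-trans (⟨⟩-unique h ≈-refl (≈-sym π₁h≈π₂h)) (≈-sym (⟨⟩-unique _ π₁∘Δ π₂∘Δ))

  mono⁂-reflects-π-equal : ∀ {X A B} {f : A ⇒ B} {h : X ⇒ A ⊗ A} → Mono f →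
    (π₁ ∘ ((f ⁂ f) ∘ h) ≈ π₂ ∘ ((f ⁂ f) ∘ h)) ⇔ (π₁ ∘ h ≈ π₂ ∘ h)
  mono⁂-reflects-π-equal mono = mk⇔
    (λ eq → mono _ _ (≈-trans (≈-sym π₁∘⁂) (≈-trans eq π₂∘⁂)))
    (λ eq → ≈-trans π₁∘⁂ (≈-trans (∘-resp-≈ʳ eq) (≈-sym π₂∘⁂)))

module DoctrineProperties {o ℓ e c ℓ₁ ℓ₂} {𝒞 : CartesianCategory o ℓ e}
                          (D : PrimaryDoctrine 𝒞 c ℓ₁ ℓ₂) where
  open CartesianCategory 𝒞
  open Category category
  open PrimaryDoctrine D
  open CartesianProperties 𝒞

  infix 4 _⊩_
  _⊩_ : ∀ {X A} → X ⇒ A → PA.Carrier A → Set ℓ₂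
  _⊩_ {X} g α = PA._≤_ X (PA.⊤ X) (reindex g α)

  ⊩-resp-≈ : ∀ {X A} {g g' : X ⇒ A} {α : PA.Carrier A} → g ≈ g' → g ⊩ α → g' ⊩ α
  ⊩-resp-≈ {X} {α = α} g≈g' g⊩α = PA.trans X g⊩α (PA.reflexive X (reindex-resp g≈g' α))

  ⊩-∘ : ∀ {X Y A} {g : Y ⇒ A} {α : PA.Carrier A} (h : X ⇒ Y) → g ⊩ α → g ∘ h ⊩ α
  ⊩-∘ {X} {g = g} {α} h g⊩α =
    PA.trans X (PA.reflexive X (PA.Eq.sym X (reindex-⊤ h)))
      (PA.trans X (reindex-mono h g⊩α) (PA.reflexive X (PA.Eq.sym X (reindex-∘ h g α))))

  ⊩-reindex : ∀ {X A B} {g : X ⇒ A} {f : A ⇒ B} {α : PA.Carrier B} →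
              g ⊩ reindex f α ⇔ f ∘ g ⊩ α
  ⊩-reindex {X} {g = g} {f} {α} = mk⇔
    (λ ⊩fα → PA.trans X ⊩fα (PA.reflexive X (PA.Eq.sym X (reindex-∘ g f α))))
    (λ ⊩α → PA.trans X ⊩α (PA.reflexive X (reindex-∘ g f α)))

  ≤-by-⊩ : HasFullComprehensions D → ∀ {A} {α β : PA.Carrier A} →
           (∀ {X} (g : X ⇒ A) → g ⊩ α → g ⊩ β) → PA._≤_ A α β
  ≤-by-⊩ fullComprehensions {α = α} α⇒β with fullComprehensions α
  ... | _ , cα , (cα⊩α , _) , full = full _ (α⇒β cα cα⊩α)

  ≈-by-⊩ : HasFullComprehensions D → ∀ {A} {α β : PA.Carrier A} →
           (∀ {X} (g : X ⇒ A) → g ⊩ α ⇔ g ⊩ β) → PA._≈_ A α β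
  ≈-by-⊩ fullComprehensions {A} α⇔β = PA.antisym A
    (≤-by-⊩ fullComprehensions λ g → Equivalence.to (α⇔β g))
    (≤-by-⊩ fullComprehensions λ g → Equivalence.from (α⇔β g))

  module _ (E : Elementary D) where
    open Elementary E

    ⊩δ⇔π-equal : ∀ {X A} {g : X ⇒ A ⊗ A} → IsComprehension D (δ A) Δ →
                 g ⊩ δ A ⇔ π₁ ∘ g ≈ π₂ ∘ g
    ⊩δ⇔π-equal {g = g} (Δ⊩δ , factor) = mk⇔
      (λ g⊩δ → let _ , g≈Δk , _ = factor g g⊩δ in
        ≈-trans (∘-resp-≈ʳ g≈Δk) (≈-trans π₁∘Δ (≈-sym (≈-trans (∘-resp-≈ʳ g≈Δk) π₂∘Δ))))
      (λ π₁g≈π₂g → ⊩-resp-≈ (≈-sym (factor-through-Δ π₁g≈π₂g)) (⊩-∘ (π₁ ∘ g) Δ⊩δ))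

corollary4p8 : ∀ {o ℓ e c ℓ₁ ℓ₂} (𝒞 : CartesianCategory o ℓ e) (D : PrimaryDoctrine 𝒞 c ℓ₁ ℓ₂) (E : Elementary D) →
    HasFullComprehensions D → HasComprehensiveEqualizers D E →
    ∀ {A B} (f : Category._⇒_ (CartesianCategory.category 𝒞) A B) →
    CartesianCategory.Mono 𝒞 f →
    BoundedMeetSemilattice._≈_ (PrimaryDoctrine.P D (CartesianCategory._⊗_ 𝒞 A A))
      (PrimaryDoctrine.reindex D (CartesianCategory._⁂_ 𝒞 f f) (Elementary.δ E B))
      (Elementary.δ E A)
corollary4p8 𝒞 D E fullComprehensions equalizers {A} {B} f mono =
  ≈-by-⊩ fullComprehensions λ g → begin
    g ⊩ reindex (f ⁂ f) (δ B)                 ∼⟨ ⊩-reindex ⟩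
    (f ⁂ f) ∘ g ⊩ δ B                          ∼⟨ ⊩δ⇔π-equal E (proj₁ (equalizers B)) ⟩
    π₁ ∘ ((f ⁂ f) ∘ g) ≈ π₂ ∘ ((f ⁂ f) ∘ g)   ∼⟨ mono⁂-reflects-π-equal mono ⟩
    π₁ ∘ g ≈ π₂ ∘ g                            ∼⟨ ⇔-sym (⊩δ⇔π-equal E (proj₁ (equalizers A))) ⟩
    g ⊩ δ A                                    ∎
  where
  open CartesianCategory 𝒞
  open Category category
  open PrimaryDoctrine D
  open Elementary E
  open CartesianProperties 𝒞
  open DoctrineProperties D
  open EquationalReasoning {k = equivalence}
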